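{- Let $w \in S_n$ be a permutation. If $|C(w)| = 1$, then $|B(w)| = |R(w)|$. If $|B(w)| = 1$, then $|C(w)| = |R(w)|$.
   Context: $S_n$ is generated by the adjacent transpositions $s_1,\dots,s_{n-1}$. A reduced word for $w$ is a sequence $i_1\cdots i_k$ with $w = s_{i_1}\cdots s_{i_k}$ and $k=\ell(w)$ minimal; $R(w)$ is the set of reduced words of $w$. A braid move replaces a factor (consecutive letters) $i(i+1)i$ by $(i+1)i(i+1)$ or vice versa; a commutation move replaces a factor $ij$ with $|i-j|>1$ by $ji$. $B(w)$ is the set of equivalence classes of $R(w)$ under sequences of braid moves, and $C(w)$ is the set of equivalence classes of $R(w)$ under sequences of commutation moves. -}

module Defs where

open import Level using (0ℓ)
open import Data.Nat using (ℕ; zero; suc; _≤_; _<_; _∸_)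
open import Data.Nat.Properties using (_≟_)
open import Data.Fin using (Fin; toℕ)
open import Data.Fin.Permutation using (Permutation′; _⟨$⟩ʳ_)
open import Data.List using (List; []; _∷_; _++_; length; foldr)
open import Data.List.Relation.Unary.All using (All)
open import Data.Product using (Σ; _×_; proj₁)
open import Data.Sum using (_⊎_)
open import Relation.Nullary using (yes; no)
open import Relation.Binary.Bundles using (Setoid)
open import Relation.Binary.PropositionalEquality as ≡ using (_≡_)
open import Relation.Binary.Construct.Closure.Equivalence as EqC using (EqClosure)
import Relation.Binary.Construct.On as On
open import Function.Bundles using (Inverse)

-- A word is a list of letters; letter i stands for the adjacent
-- transposition s_i = (i-1 i) acting on {0,…,n-1} (0-based positions).
Word : Set
Word = List ℕ

sAct : ℕ → ℕ → ℕ
sAct i x with x ≟ i ∸ 1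
... | yes _ = i
... | no _ with x ≟ i
...   | yes _ = i ∸ 1
...   | no _ = x

wordAct : Word → ℕ → ℕ
wordAct ws x = foldr sAct x ws

ValidWord : ℕ → Word → Set
ValidWord n ws = All (λ i → 1 ≤ i × i < n) ws

IsWordFor : {n : ℕ} → Permutation′ n → Word → Set
IsWordFor {n} w ws =
  ValidWord n ws × ((x : Fin n) → toℕ (w ⟨$⟩ʳ x) ≡ wordAct ws (toℕ x))

IsReduced : {n : ℕ} → Permutation′ n → Word → Set
IsReduced w ws = IsWordFor w ws × ((vs : Word) → IsWordFor w vs → length ws ≤ length vs)

Red : {n : ℕ} → Permutation′ n → Set
Red w = Σ Word (IsReduced w)

data BraidStep : Word → Word → Set where
  braid : (u v : Word) (i : ℕ) →
    BraidStep (u ++ i ∷ suc i ∷ i ∷ v) (u ++ suc i ∷ i ∷ suc i ∷ v)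

data CommStep : Word → Word → Set where
  comm : (u v : Word) (i j : ℕ) → (suc i < j ⊎ suc j < i) →
    CommStep (u ++ i ∷ j ∷ v) (u ++ j ∷ i ∷ v)

RSetoid : {n : ℕ} → Permutation′ n → Setoid 0ℓ 0ℓ
RSetoid w = On.setoid (≡.setoid Word) (proj₁ {B = IsReduced w})

BSetoid : {n : ℕ} → Permutation′ n → Setoid 0ℓ 0ℓ
BSetoid w = On.setoid (EqC.setoid BraidStep) (proj₁ {B = IsReduced w})

CSetoid : {n : ℕ} → Permutation′ n → Setoid 0ℓ 0ℓ
CSetoid w = On.setoid (EqC.setoid CommStep) (proj₁ {B = IsReduced w})

HasCard : Setoid 0ℓ 0ℓ → ℕ → Set
HasCard S k = Inverse (≡.setoid (Fin k)) S

-- A braid move changes the sum of the letters by one, while commutation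
-- moves only permute the letters; so if all reduced words of w are
-- commutation equivalent, no braid move joins two reduced words.  Dually,
-- for each m the assignment s_k ↦ (0 1) for k ≤ m, s_k ↦ (1 2) for k > m
-- into S₃ respects braid moves but separates s_m s_j from s_j s_m when
-- m < j; so if all reduced words are braid equivalent, no commutation move
-- joins two reduced words.  In either case the other equivalence is just
-- equality on R(w), and its quotient is a copy of R(w).
module Submission where

open import Defs
open import Data.Nat using (ℕ)
open import Data.Product using (_×_)
open import Data.Fin.Permutation using (Permutation′)

open import Level using (0ℓ)
open import Data.Bool using (Bool; true; false)
open import Data.Empty using (⊥; ⊥-elim)
open import Data.Fin using (Fin; zero; suc)
open import Data.List using ([]; _∷_; _++_; length; foldr; map)
open import Data.List.Properties using (foldr-++; length-++)
open import Data.List.Relation.Binary.Permutation.Propositional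
  using (_↭_; swap; ↭-refl; ↭-isEquivalence)
open import Data.List.Relation.Binary.Permutation.Propositional.Properties using (++⁺ˡ)
open import Data.List.Relation.Unary.All using (All; []; _∷_)
open import Data.List.Relation.Unary.All.Properties using (++⁺; ++⁻; ++⁻ˡ; ++⁻ʳ)
open import Data.Nat using (suc; zero; _+_; _≤_; _<_; _≤ᵇ_; s≤s; z≤n)
open import Data.Nat.ListAction using (sum)
open import Data.Nat.ListAction.Properties using (sum-++; sum-↭)
open import Data.Nat.Properties using (_≟_; suc-injective; 1+n≢n; +-suc; <⇒≤)
open import Data.Product using (∃-syntax; _,_; proj₁)
open import Data.Sum using (_⊎_; inj₁; inj₂)
import Data.Sum as Sum
open import Function using (_∘′_; id)
open import Function.Bundles using (Inverse)
import Function.Construct.Composition as Composition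
open import Relation.Binary using (Rel)
open import Relation.Binary.Bundles using (Setoid)
import Relation.Binary.Reasoning.Setoid as SetoidReasoning
open import Relation.Binary.Construct.Closure.Equivalence as EqC using (EqClosure)
open import Relation.Binary.Construct.Closure.ReflexiveTransitive using (ε; _◅_)
open import Relation.Binary.Construct.Closure.Symmetric using (SymClosure; fwd; bwd)
import Relation.Binary.Construct.On as On
open import Relation.Binary.PropositionalEquality using (_→-setoid_)
open import Relation.Binary.PropositionalEquality
  using (_≡_; _≢_; _≗_; refl; sym; trans; cong; subst; subst₂; ≢-sym; module ≡-Reasoning)
open import Relation.Nullary using (Dec; yes; no)

sAct-swapsˡ : ∀ i → sAct (suc i) i ≡ suc i
sAct-swapsˡ i with i ≟ i
... | yes _ = refl
... | no i≢i = ⊥-elim (i≢i refl)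

sAct-swapsʳ : ∀ i → sAct (suc i) (suc i) ≡ i
sAct-swapsʳ i with suc i ≟ i
... | yes 1+i≡i = ⊥-elim (1+n≢n 1+i≡i)
... | no _ with suc i ≟ suc i
...   | yes _ = refl
...   | no 1+i≢1+i = ⊥-elim (1+i≢1+i refl)

sAct-fixes : ∀ i z → z ≢ i → z ≢ suc i → sAct (suc i) z ≡ z
sAct-fixes i z z≢i z≢1+i with z ≟ i
... | yes z≡i = ⊥-elim (z≢i z≡i)
... | no _ with z ≟ suc i
...   | yes z≡1+i = ⊥-elim (z≢1+i z≡1+i)
...   | no _ = refl

sAct-suc : ∀ i z → sAct (2 + i) (suc z) ≡ suc (sAct (suc i) z)
sAct-suc i z = by-cases (z ≟ i) (z ≟ suc i)
  where
  by-cases : Dec (z ≡ i) → Dec (z ≡ suc i) → sAct (2 + i) (suc z) ≡ suc (sAct (suc i) z)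
  by-cases (yes refl) _ rewrite sAct-swapsˡ z | sAct-swapsˡ (suc z) = refl
  by-cases (no _) (yes refl) rewrite sAct-swapsʳ i | sAct-swapsʳ (suc i) = refl
  by-cases (no z≢i) (no z≢1+i)
    rewrite sAct-fixes i z z≢i z≢1+i
          | sAct-fixes (suc i) (suc z) (z≢i ∘′ suc-injective) (z≢1+i ∘′ suc-injective) = refl

wordAct-map-suc : ∀ ws → All (1 ≤_) ws → ∀ z → wordAct (map suc ws) (suc z) ≡ suc (wordAct ws z)
wordAct-map-suc [] [] z = refl
wordAct-map-suc (suc i ∷ ws) (_ ∷ ps) z = begin
  sAct (2 + i) (wordAct (map suc ws) (suc z)) ≡⟨ cong (sAct (2 + i)) (wordAct-map-suc ws ps z) ⟩
  sAct (2 + i) (suc (wordAct ws z))          ≡⟨ sAct-suc i (wordAct ws z) ⟩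
  suc (sAct (suc i) (wordAct ws z))          ∎
  where open ≡-Reasoning

-- Shifting all letters up by one conjugates the action by suc, so both
-- relations follow by induction from the case where the smaller letter is 1.
wordAct-shift-cong : ∀ ws vs → All (1 ≤_) ws → All (1 ≤_) vs → wordAct ws ≗ wordAct vs →
  ∀ z → wordAct (map suc ws) (suc z) ≡ wordAct (map suc vs) (suc z)
wordAct-shift-cong ws vs 1≤ws 1≤vs ws≗vs z = begin
  wordAct (map suc ws) (suc z) ≡⟨ wordAct-map-suc ws 1≤ws z ⟩
  suc (wordAct ws z)           ≡⟨ cong suc (ws≗vs z) ⟩
  suc (wordAct vs z)           ≡⟨ wordAct-map-suc vs 1≤vs z ⟨
  wordAct (map suc vs) (suc z) ∎
  where open ≡-Reasoning

braid-relation : ∀ i → 1 ≤ i → wordAct (i ∷ suc i ∷ i ∷ []) ≗ wordAct (suc i ∷ i ∷ suc i ∷ [])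
braid-relation 1 _ 0 = refl
braid-relation 1 _ 1 = refl
braid-relation 1 _ 2 = refl
braid-relation 1 _ (suc (suc (suc z))) = refl
braid-relation (suc (suc i)) _ zero = refl
braid-relation (suc (suc i)) _ (suc z) =
  wordAct-shift-cong (suc i ∷ 2 + i ∷ suc i ∷ []) (2 + i ∷ suc i ∷ 2 + i ∷ [])
    (s≤s z≤n ∷ s≤s z≤n ∷ s≤s z≤n ∷ []) (s≤s z≤n ∷ s≤s z≤n ∷ s≤s z≤n ∷ [])
    (braid-relation (suc i) (s≤s z≤n)) z

commutation-relation : ∀ i j → 1 ≤ i → suc i < j → wordAct (i ∷ j ∷ []) ≗ wordAct (j ∷ i ∷ [])
commutation-relation 1 (suc (suc (suc j))) _ (s≤s (s≤s (s≤s _))) 0 = refl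
commutation-relation 1 (suc (suc (suc j))) _ (s≤s (s≤s (s≤s _))) 1 = refl
commutation-relation 1 (suc (suc (suc j))) _ (s≤s (s≤s (s≤s _))) (suc (suc z))
  rewrite sAct-suc (suc j) (suc z) | sAct-suc j z = refl
commutation-relation (suc (suc i)) (suc (suc j)) _ (s≤s (s≤s _)) zero = refl
commutation-relation (suc (suc i)) (suc (suc j)) _ (s≤s i+1<j) (suc z) =
  wordAct-shift-cong (suc i ∷ suc j ∷ []) (suc j ∷ suc i ∷ [])
    (s≤s z≤n ∷ s≤s z≤n ∷ []) (s≤s z≤n ∷ s≤s z≤n ∷ [])
    (commutation-relation (suc i) (suc j) (s≤s z≤n) i+1<j) z

distant-commute : ∀ {i j} → 1 ≤ i → 1 ≤ j → (suc i < j ⊎ suc j < i) →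
  wordAct (i ∷ j ∷ []) ≗ wordAct (j ∷ i ∷ [])
distant-commute {i} {j} 1≤i _ (inj₁ i+1<j) = commutation-relation i j 1≤i i+1<j
distant-commute {i} {j} _ 1≤j (inj₂ j+1<i) = λ z → sym (commutation-relation j i 1≤j j+1<i z)

foldr-cong-factor : ∀ {A B : Set} (f : A → B → B) u v {a b} →
  (∀ z → foldr f z a ≡ foldr f z b) → ∀ z → foldr f z (u ++ a ++ v) ≡ foldr f z (u ++ b ++ v)
foldr-cong-factor f u v {a} {b} a≗b z = begin
  foldr f z (u ++ a ++ v)                   ≡⟨ foldr-++ f z u (a ++ v) ⟩
  foldr f (foldr f z (a ++ v)) u            ≡⟨ cong (λ y → foldr f y u) (foldr-++ f z a v) ⟩
  foldr f (foldr f (foldr f z v) a) u       ≡⟨ cong (λ y → foldr f y u) (a≗b (foldr f z v)) ⟩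
  foldr f (foldr f (foldr f z v) b) u       ≡⟨ cong (λ y → foldr f y u) (foldr-++ f z b v) ⟨
  foldr f (foldr f z (b ++ v)) u            ≡⟨ foldr-++ f z u (b ++ v) ⟨
  foldr f z (u ++ b ++ v)                   ∎
  where open ≡-Reasoning

length-cong-factor : ∀ u v {a b : Word} → length a ≡ length b → length (u ++ a ++ v) ≡ length (u ++ b ++ v)
length-cong-factor u v {a} {b} |a|≡|b| = begin
  length (u ++ a ++ v)              ≡⟨ length-++ u ⟩
  length u + length (a ++ v)        ≡⟨ cong (length u +_) (length-++ a) ⟩
  length u + (length a + length v)  ≡⟨ cong (λ k → length u + (k + length v)) |a|≡|b| ⟩
  length u + (length b + length v)  ≡⟨ cong (length u +_) (length-++ b) ⟨
  length u + length (b ++ v)        ≡⟨ length-++ u ⟨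
  length (u ++ b ++ v)              ∎
  where open ≡-Reasoning

valid-factor : ∀ {n} u v {a} → ValidWord n (u ++ a ++ v) → ValidWord n a
valid-factor u v {a} valid = ++⁻ˡ a (++⁻ʳ u valid)

valid-replace : ∀ {n} u v {a b} → ValidWord n b → ValidWord n (u ++ a ++ v) → ValidWord n (u ++ b ++ v)
valid-replace u v {a} valid-b valid with ++⁻ u valid
... | valid-u , valid-av = ++⁺ valid-u (++⁺ valid-b (++⁻ʳ a valid-av))

hasCard1⇒≈ : ∀ {S : Setoid 0ℓ 0ℓ} → HasCard S 1 → ∀ x y → Setoid._≈_ S x y
hasCard1⇒≈ {S} card x y = begin
  x              ≈⟨ strictlyInverseˡ x ⟨
  to (from x)    ≡⟨ cong to (Fin1-unique (from x) (from y)) ⟩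
  to (from y)    ≈⟨ strictlyInverseˡ y ⟩
  y              ∎
  where
  open SetoidReasoning S
  open Inverse card
  Fin1-unique : (a b : Fin 1) → a ≡ b
  Fin1-unique zero zero = refl

commStep⇒↭ : ∀ {x y} → CommStep x y → x ↭ y
commStep⇒↭ (comm u v i j _) = ++⁺ˡ u (swap i j ↭-refl)

commEquivalent⇒sum≡ : ∀ {x y} → EqClosure CommStep x y → sum x ≡ sum y
commEquivalent⇒sum≡ = sum-↭ ∘′ EqC.fold ↭-isEquivalence commStep⇒↭

braidStep-sum : ∀ {x y} → BraidStep x y → sum y ≡ suc (sum x)
braidStep-sum (braid u v i) = begin
  sum (u ++ suc i ∷ i ∷ suc i ∷ v)        ≡⟨ sum-++ u _ ⟩
  sum u + suc (i + (i + suc (i + s)))      ≡⟨ cong (λ k → sum u + suc (i + k)) (+-suc i (i + s)) ⟩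
  sum u + suc (i + suc (i + (i + s)))      ≡⟨ +-suc (sum u) _ ⟩
  suc (sum u + (i + suc (i + (i + s))))    ≡⟨ cong suc (sum-++ u _) ⟨
  suc (sum (u ++ i ∷ suc i ∷ i ∷ v))      ∎
  where
  open ≡-Reasoning
  s = sum v

braidMove⇒sum≢ : ∀ {x y} → SymClosure BraidStep x y → sum x ≢ sum y
braidMove⇒sum≢ (fwd step) x≡y = 1+n≢n (trans (sym (braidStep-sum step)) (sym x≡y))
braidMove⇒sum≢ (bwd step) x≡y = 1+n≢n (trans (sym (braidStep-sum step)) x≡y)

σ : Bool → Fin 3 → Fin 3
σ true zero = suc zero
σ true (suc zero) = zero
σ true (suc (suc zero)) = suc (suc zero)
σ false zero = zero
σ false (suc zero) = suc (suc zero)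
σ false (suc (suc zero)) = suc zero

σ-involutive : ∀ b x → σ b (σ b x) ≡ x
σ-involutive true zero = refl
σ-involutive true (suc zero) = refl
σ-involutive true (suc (suc zero)) = refl
σ-involutive false zero = refl
σ-involutive false (suc zero) = refl
σ-involutive false (suc (suc zero)) = refl

σ-braid : ∀ a b x → σ a (σ b (σ a x)) ≡ σ b (σ a (σ b x))
σ-braid true true x = refl
σ-braid false false x = refl
σ-braid true false zero = refl
σ-braid true false (suc zero) = refl
σ-braid true false (suc (suc zero)) = refl
σ-braid false true zero = refl
σ-braid false true (suc zero) = refl
σ-braid false true (suc (suc zero)) = refl

-- σ true ∘ σ false and σ false ∘ σ true are the two 3-cycles, which disagree everywhere.
σ-noncommuting : ∀ x → σ true (σ false x) ≢ σ false (σ true x)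
σ-noncommuting zero ()
σ-noncommuting (suc zero) ()
σ-noncommuting (suc (suc zero)) ()

φ : ℕ → Word → Fin 3 → Fin 3
φ m ws x = foldr (λ k → σ (k ≤ᵇ m)) x ws

φ-++ : ∀ m us vs → φ m (us ++ vs) ≗ φ m us ∘′ φ m vs
φ-++ m us vs x = foldr-++ (λ k → σ (k ≤ᵇ m)) x us vs

φ-injective : ∀ m us {x y} → φ m us x ≡ φ m us y → x ≡ y
φ-injective m [] eq = eq
φ-injective m (k ∷ us) {x} {y} eq = φ-injective m us (begin
  φ m us x                                   ≡⟨ σ-involutive (k ≤ᵇ m) _ ⟨
  σ (k ≤ᵇ m) (σ (k ≤ᵇ m) (φ m us x))         ≡⟨ cong (σ (k ≤ᵇ m)) eq ⟩
  σ (k ≤ᵇ m) (σ (k ≤ᵇ m) (φ m us y))         ≡⟨ σ-involutive (k ≤ᵇ m) _ ⟩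
  φ m us y                                   ∎)
  where open ≡-Reasoning

braidEquivalent⇒φ≗ : ∀ m {x y} → EqClosure BraidStep x y → φ m x ≗ φ m y
braidEquivalent⇒φ≗ m = EqC.gfold (Setoid.isEquivalence (Fin 3 →-setoid Fin 3)) (φ m)
  λ { (braid u v i) → foldr-cong-factor (λ k → σ (k ≤ᵇ m)) u v (σ-braid (i ≤ᵇ m) (suc i ≤ᵇ m)) }

≤ᵇ-refl : ∀ i → (i ≤ᵇ i) ≡ true
≤ᵇ-refl zero = refl
≤ᵇ-refl (suc zero) = refl
≤ᵇ-refl (suc (suc i)) = ≤ᵇ-refl (suc i)

>⇒≤ᵇ≡false : ∀ {m n} → n < m → (m ≤ᵇ n) ≡ false
>⇒≤ᵇ≡false {suc m} {zero} _ = refl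
>⇒≤ᵇ≡false {suc (suc m)} {suc n} (s≤s n<m) = >⇒≤ᵇ≡false n<m

commStep-separates : ∀ u v i j → i < j → φ i (u ++ i ∷ j ∷ v) zero ≢ φ i (u ++ j ∷ i ∷ v) zero
commStep-separates u v i j i<j eq =
  σ-noncommuting y (subst₂ (λ a b → σ a (σ b y) ≡ σ b (σ a y)) (≤ᵇ-refl i) (>⇒≤ᵇ≡false i<j) middle)
  where
  y = φ i v zero
  middle : σ (i ≤ᵇ i) (σ (j ≤ᵇ i) y) ≡ σ (j ≤ᵇ i) (σ (i ≤ᵇ i) y)
  middle = φ-injective i u (trans (sym (φ-++ i u _ zero)) (trans eq (φ-++ i u _ zero)))

commMove-separates : ∀ {x y} → SymClosure CommStep x y → ∃[ m ] φ m x zero ≢ φ m y zero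
commMove-separates (fwd (comm u v i j (inj₁ i+1<j))) = i , commStep-separates u v i j (<⇒≤ i+1<j)
commMove-separates (fwd (comm u v i j (inj₂ j+1<i))) = j , ≢-sym (commStep-separates u v j i (<⇒≤ j+1<i))
commMove-separates (bwd (comm u v i j (inj₁ i+1<j))) = i , ≢-sym (commStep-separates u v i j (<⇒≤ i+1<j))
commMove-separates (bwd (comm u v i j (inj₂ j+1<i))) = j , commStep-separates u v j i (<⇒≤ j+1<i)

module _ {n : ℕ} {w : Permutation′ n} where

  reduced-replace : ∀ u v {a b} →
    length a ≡ length b → ValidWord n b → wordAct a ≗ wordAct b →
    IsReduced w (u ++ a ++ v) → IsReduced w (u ++ b ++ v)
  reduced-replace u v |a|≡|b| valid-b a≗b ((valid , acts) , minimal) =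
    ( valid-replace u v valid-b valid
    , λ x → trans (acts x) (foldr-cong-factor sAct u v a≗b _) )
    , λ vs isWord → subst (_≤ length vs) (length-cong-factor u v |a|≡|b|) (minimal vs isWord)

  braidMove-reduced : ∀ {x y} → SymClosure BraidStep x y → IsReduced w x → IsReduced w y
  braidMove-reduced (fwd (braid u v i)) red@((valid , _) , _)
    with valid-factor u v valid
  ... | p ∷ q ∷ _ ∷ [] = reduced-replace u v refl (q ∷ p ∷ q ∷ []) (braid-relation i (proj₁ p)) red
  braidMove-reduced (bwd (braid u v i)) red@((valid , _) , _)
    with valid-factor u v valid
  ... | p ∷ q ∷ _ ∷ [] = reduced-replace u v refl (q ∷ p ∷ q ∷ []) (λ z → sym (braid-relation i (proj₁ q) z)) red

  commMove-reduced : ∀ {x y} → SymClosure CommStep x y → IsReduced w x → IsReduced w y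
  commMove-reduced (fwd (comm u v i j far)) red@((valid , _) , _)
    with valid-factor u v valid
  ... | p ∷ q ∷ [] = reduced-replace u v refl (q ∷ p ∷ []) (distant-commute (proj₁ p) (proj₁ q) far) red
  commMove-reduced (bwd (comm u v i j far)) red@((valid , _) , _)
    with valid-factor u v valid
  ... | p ∷ q ∷ [] = reduced-replace u v refl (q ∷ p ∷ []) (distant-commute (proj₁ p) (proj₁ q) (Sum.swap far)) red

  NoMoveOnReduced : Rel Word 0ℓ → Set
  NoMoveOnReduced Step = ∀ {x y} → SymClosure Step x y → IsReduced w x → ⊥

  R≅quotient : ∀ {Step} → NoMoveOnReduced Step →
    Inverse (RSetoid w) (On.setoid (EqC.setoid Step) (proj₁ {B = IsReduced w}))
  R≅quotient {Step} stuck = record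
    { to        = id
    ; from      = id
    ; to-cong   = ≡⇒equivalent
    ; from-cong = λ {x} → equivalent⇒≡ x
    ; inverse   = ≡⇒equivalent , λ {_} {y} → equivalent⇒≡ y
    }
    where
    ≡⇒equivalent : ∀ {x y : Word} → x ≡ y → EqClosure Step x y
    ≡⇒equivalent refl = ε
    equivalent⇒≡ : ∀ (x : Red w) {y} → EqClosure Step (proj₁ x) y → proj₁ x ≡ y
    equivalent⇒≡ _       ε                = refl
    equivalent⇒≡ (_ , red) (move ◅ _) = ⊥-elim (stuck move red)

  C1⇒noBraidMove : HasCard (CSetoid w) 1 → NoMoveOnReduced BraidStep
  C1⇒noBraidMove card move red =
    braidMove⇒sum≢ move (commEquivalent⇒sum≡ (hasCard1⇒≈ card (_ , red) (_ , braidMove-reduced move red)))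

  B1⇒noCommMove : HasCard (BSetoid w) 1 → NoMoveOnReduced CommStep
  B1⇒noCommMove card move red with commMove-separates move
  ... | m , separated =
    separated (braidEquivalent⇒φ≗ m (hasCard1⇒≈ card (_ , red) (_ , commMove-reduced move red)) zero)

lemma4p7 : (n : ℕ) (w : Permutation′ n) →
    (HasCard (CSetoid w) 1 → (k : ℕ) → HasCard (RSetoid w) k → HasCard (BSetoid w) k)
    × (HasCard (BSetoid w) 1 → (k : ℕ) → HasCard (RSetoid w) k → HasCard (CSetoid w) k)
lemma4p7 n w =
  (λ C1 k R≅k → Composition.inverse R≅k (R≅quotient {w = w} (C1⇒noBraidMove {w = w} C1))) ,
  (λ B1 k R≅k → Composition.inverse R≅k (R≅quotient {w = w} (B1⇒noCommMove {w = w} B1)))
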